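{- Let $k$ be an algebraically closed field and let $P$ be a finite poset with $n$ elements and a linear extension $P=\{x_1,\dots,x_n\}$. If the incidence monoid $I(P)$ is a toric $\mathbf{T}_n\times\mathbf{T}_n$-variety, then the number of nontrivial relations of $P$ is at most $n-1$.
   Context: Via the linear extension ($x_i\le x_j\Rightarrow i\le j$), the incidence algebra $I(P)$ is identified with $\{(f_{ij})\text{ upper triangular } n\times n: f_{ij}=0\text{ unless }x_i\le x_j\}$. $\mathbf{T}_n$ is the torus of invertible diagonal $n\times n$ matrices, and $\mathbf{T}_n\times\mathbf{T}_n$ acts on $I(P)$ by $(s,t)\cdot x=sxt^{ -1}$. A toric variety for a torus action is an irreducible normal variety on which the torus has an open dense orbit. A relation $x\le y$ in $P$ is nontrivial if $x\ne y$. -}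

module Defs where

open import Level using (Level; _⊔_) renaming (suc to lsuc)
open import Algebra.Bundles using (CommutativeRing)
open import Data.Nat using (ℕ; zero; suc)
open import Data.Fin using (Fin; _≟_) renaming (_≤_ to _≤ᶠ_)
open import Data.List using (List; []; _∷_; length; filter; cartesianProduct; allFin)
open import Data.List.Relation.Unary.All using (All)
open import Data.Product using (Σ; ∃; _×_; _,_; proj₁; proj₂)
open import Relation.Nullary using (¬_)
open import Relation.Nullary.Decidable using (¬?; _×-dec_)
open import Relation.Binary using (Decidable; IsPartialOrder)
open import Relation.Binary.PropositionalEquality using (_≡_)

module _ {c ℓ : Level} (K : CommutativeRing c ℓ) where
  open CommutativeRing K

  -- x^d + a_{d-1} x^{d-1} + ... + a_0 with coefficient list [a_0,…,a_{d-1}]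
  -- evaluated by Horner: monicEval as x = x^(length as) + Σ a_i x^i
  monicEval : List Carrier → Carrier → Carrier
  monicEval []       x = 1#
  monicEval (a ∷ as) x = a + x * monicEval as x

  record IsAlgClosedField : Set (c ⊔ ℓ) where
    field
      0≉1      : ¬ (0# ≈ 1#)
      inverse  : ∀ x → ¬ (x ≈ 0#) → ∃ λ y → x * y ≈ 1#
      hasRoot  : ∀ (a : Carrier) (as : List Carrier) → ∃ λ x → monicEval (a ∷ as) x ≈ 0#

record FinPoset (n : ℕ) : Set₁ where
  field
    _≤P_           : Fin n → Fin n → Set
    isPartialOrder : IsPartialOrder _≡_ _≤P_
    _≤P?_          : Decidable _≤P_
    linExt         : ∀ {i j} → i ≤P j → i ≤ᶠ j

nontrivialRelations : ∀ {n} → FinPoset n → ℕ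
nontrivialRelations {n} P =
  length (filter (λ p → ¬? (proj₁ p ≟ proj₂ p) ×-dec (proj₁ p ≤P? proj₂ p))
                 (cartesianProduct (allFin n) (allFin n)))
  where open FinPoset P

module _ {c ℓ : Level} (K : CommutativeRing c ℓ) where
  open CommutativeRing K

  Matrix : ℕ → Set c
  Matrix n = Fin n → Fin n → Carrier

  InIncidence : ∀ {n} → FinPoset n → Matrix n → Set ℓ
  InIncidence P f = ∀ i j → ¬ (i ≤P j) → f i j ≈ 0#
    where open FinPoset P

  record Unit : Set (c ⊔ ℓ) where
    constructor unit
    field
      val   : Carrier
      inv   : Carrier
      isInv : val * inv ≈ 1#

  Torus : ℕ → Set (c ⊔ ℓ)
  Torus n = Fin n → Unit

  act : ∀ {n} → Torus n → Torus n → Matrix n → Matrix n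
  act s t x i j = Unit.val (s i) * x i j * Unit.inv (t j)

  InOrbit : ∀ {n} → Matrix n → Matrix n → Set (c ⊔ ℓ)
  InOrbit x y = ∃ λ s → ∃ λ t → ∀ i j → y i j ≈ act s t x i j

  data Poly (n : ℕ) : Set c where
    var  : Fin n → Fin n → Poly n
    con  : Carrier → Poly n
    _⊕_  : Poly n → Poly n → Poly n
    _⊗_  : Poly n → Poly n → Poly n
    neg  : Poly n → Poly n

  eval : ∀ {n} → Poly n → Matrix n → Carrier
  eval (var i j) x = x i j
  eval (con a)   x = a
  eval (p ⊕ q)   x = eval p x + eval q x
  eval (p ⊗ q)   x = eval p x * eval q x
  eval (neg p)   x = - eval p x

  InZero : ∀ {n} → List (Poly n) → Matrix n → Set (c ⊔ ℓ)
  InZero fs y = All (λ f → eval f y ≈ 0#) fs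

  IsOpenIn : ∀ {n} → FinPoset n → (Matrix n → Set (c ⊔ ℓ)) → Set (c ⊔ ℓ)
  IsOpenIn P S = ∃ λ fs → ∀ y → InIncidence P y → (S y → ¬ InZero fs y) × (¬ InZero fs y → S y)

  IsDenseIn : ∀ {n} → FinPoset n → (Matrix n → Set (c ⊔ ℓ)) → Set (c ⊔ ℓ)
  IsDenseIn P S = ∀ fs → (∀ y → S y → InZero fs y) → ∀ y → InIncidence P y → InZero fs y

  HasOpenDenseOrbit : ∀ {n} → FinPoset n → Set (c ⊔ ℓ)
  HasOpenDenseOrbit P = ∃ λ x → InIncidence P x × IsOpenIn P (InOrbit x) × IsDenseIn P (InOrbit x)

-- Density of the orbit of x gives two things: every entry x_ij with x_i ≤ x_j is nonzero, and
-- every monomial identity  y^num · x^den = y^den · x^num  valid on the orbit holds on all of I(P).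
-- Testing such an identity on the 0/1 matrix supported on the relations of P minus one entry e
-- shows that the torus characters s_i t_j⁻¹ of the coordinates of I(P) satisfy no monomial
-- relation in which e occurs on one side only.  A cycle in the graph on {1,…,n} whose edges are
-- the nontrivial relations would produce such a relation, its vertices corrected by diagonal
-- entries.  So that graph is a forest and has at most n − 1 edges; union–find either exhibits a
-- cycle or keeps  #edges + #components ≤ n.
module Submission where

open import Defs
open import Level using (Level; 0ℓ)
open import Algebra.Bundles using (CommutativeRing)
open import Data.Nat using (ℕ; zero; suc; _+_; _≤_; _<_; _∸_; z≤n; s≤s)
open import Data.Nat.Properties
  using (m≤n⇒m≤1+n; ≤-trans; ≤-reflexive; +-suc; +-monoʳ-≤; m+n≤o⇒m≤o; m+n≤o⇒m≤o∸n; ∸-monoʳ-≤)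
open import Data.Bool using (if_then_else_)
open import Data.Fin as Fin using (Fin; _≟_)
open import Data.List using (List; []; _∷_; _++_; map; foldr; length; filter; allFin; cartesianProduct)
open import Data.List.Properties using (map-++; map-∘; filter-accept; filter-reject; length-filter; length-tabulate)
open import Data.List.Membership.Propositional using (_∈_; _∉_)
open import Data.List.Membership.Propositional.Properties using (∈-allFin; ∈-filter⁺; ∈-filter⁻)
open import Data.List.Relation.Unary.All as All using (All; []; _∷_)
open import Data.List.Relation.Unary.All.Properties using (++⁺; All¬⇒¬Any; ¬Any⇒All¬; all-filter)
open import Data.List.Relation.Unary.Any using (here; there)
open import Data.List.Relation.Unary.AllPairs using (_∷_)
open import Data.List.Relation.Unary.Unique.Propositional using (Unique)
import Data.List.Relation.Unary.Unique.Propositional.Properties as Unique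
open import Data.List.Relation.Binary.Permutation.Propositional
  using (_↭_; refl; prep; swap; ↭-sym; ↭-trans; ↭-reflexive; ↭⇒↭ₛ′; module PermutationReasoning)
open import Data.List.Relation.Binary.Permutation.Propositional.Properties
  using (drop-∷; shift; map⁺) renaming (++⁺ to ++⁺-↭)
import Data.List.Relation.Binary.Permutation.Setoid.Properties as PermutationProperties
open import Data.Product using (∃; _×_; _,_; proj₁; proj₂; uncurry)
open import Data.Product.Properties using (≡-dec)
open import Data.Sum using (_⊎_; inj₁; inj₂; [_,_]′)
open import Data.Empty using (⊥; ⊥-elim)
open import Function using (_∘_)
open import Relation.Nullary using (¬_; yes; no; does)
open import Relation.Nullary.Decidable using (¬?; _×-dec_)
open import Relation.Unary using (Pred; Decidable; _⊆_)
open import Relation.Binary using (IsPartialOrder)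
open import Relation.Binary.PropositionalEquality using (_≡_; _≢_; refl; sym; trans; cong; subst)

module _ {A : Set} {P Q : Pred A 0ℓ} (P? : Decidable P) (Q? : Decidable Q) (Q⇒P : Q ⊆ P) where

  length-filter-mono : ∀ xs → length (filter Q? xs) ≤ length (filter P? xs)
  length-filter-mono [] = z≤n
  length-filter-mono (x ∷ xs) with P? x | Q? x
  ... | yes _  | yes _ = s≤s (length-filter-mono xs)
  ... | yes _  | no _  = m≤n⇒m≤1+n (length-filter-mono xs)
  ... | no ¬px | yes qx = ⊥-elim (¬px (Q⇒P qx))
  ... | no _   | no _  = length-filter-mono xs

  length-filter-< : ∀ {z} xs → z ∈ xs → P z → ¬ Q z → length (filter Q? xs) < length (filter P? xs)
  length-filter-< (x ∷ xs) (here refl) pz ¬qz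
    rewrite filter-accept P? {xs = xs} pz | filter-reject Q? {xs = xs} ¬qz = s≤s (length-filter-mono xs)
  length-filter-< (x ∷ xs) (there z∈xs) pz ¬qz with P? x | Q? x
  ... | yes _  | yes _  = s≤s (length-filter-< xs z∈xs pz ¬qz)
  ... | yes _  | no _   = m≤n⇒m≤1+n (length-filter-< xs z∈xs pz ¬qz)
  ... | no ¬px | yes qx = ⊥-elim (¬px (Q⇒P qx))
  ... | no _   | no _   = length-filter-< xs z∈xs pz ¬qz

∈⇒length≥1 : ∀ {A : Set} {x : A} {xs} → x ∈ xs → 1 ≤ length xs
∈⇒length≥1 (here _)  = s≤s z≤n
∈⇒length≥1 (there _) = s≤s z≤n

m+k≤o⇒m≤o∸1 : ∀ m {k} o → m + k ≤ o → (Fin o → 1 ≤ k) → m ≤ o ∸ 1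
m+k≤o⇒m≤o∸1 m zero    m+k≤o _    = m+n≤o⇒m≤o m m+k≤o
m+k≤o⇒m≤o∸1 m (suc o) m+k≤o k≥1 = ≤-trans (m+n≤o⇒m≤o∸n m m+k≤o) (∸-monoʳ-≤ (suc o) (k≥1 Fin.zero))

↭-∷-trans : ∀ {A : Set} {u v w : A} {xs ys xs′ ys′} →
            w ∷ xs ↭ v ∷ ys → u ∷ xs′ ↭ w ∷ ys′ → u ∷ xs ++ xs′ ↭ v ∷ ys ++ ys′
↭-∷-trans {u = u} {v} {w} {xs} {ys} {xs′} {ys′} p q = drop-∷ (begin
  w ∷ u ∷ xs ++ xs′    ↭⟨ prep w (↭-sym (shift u xs xs′)) ⟩
  w ∷ xs ++ u ∷ xs′    ↭⟨ ++⁺-↭ p q ⟩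
  v ∷ ys ++ w ∷ ys′    ↭⟨ prep v (shift w ys ys′) ⟩
  v ∷ w ∷ ys ++ ys′    ↭⟨ swap v w refl ⟩
  w ∷ v ∷ ys ++ ys′    ∎)
  where open PermutationReasoning

Entry : ℕ → Set
Entry n = Fin n × Fin n

module _ {n : ℕ} where

  rows cols : List (Entry n) → List (Fin n)
  rows = map proj₁
  cols = map proj₂

  -- num and den have the same T × T-weight
  Balanced : List (Entry n) → List (Entry n) → Set
  Balanced num den = rows num ↭ rows den × cols num ↭ cols den

  OnDiagonalOrIn : List (Entry n) → Pred (Entry n) 0ℓ
  OnDiagonalOrIn L e = proj₁ e ≡ proj₂ e ⊎ e ∈ L

  -- A Laurent monomial num / den in the entries of L and of the diagonal
  -- whose T × T-weight is (v − w, 0).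
  record Connection (L : List (Entry n)) (v w : Fin n) : Set where
    field
      num den       : List (Entry n)
      num-supported : All (OnDiagonalOrIn L) num
      den-supported : All (OnDiagonalOrIn L) den
      rows-shifted  : w ∷ rows num ↭ v ∷ rows den
      cols-balanced : cols num ↭ cols den

  module _ {L : List (Entry n)} where
    open Connection

    connection-refl : ∀ v → Connection L v v
    connection-refl v = record { num = [] ; den = [] ; num-supported = [] ; den-supported = []
                         ; rows-shifted = refl ; cols-balanced = refl }

    connection-sym : ∀ {v w} → Connection L v w → Connection L w v
    connection-sym c = record { num = den c ; den = num c
                         ; num-supported = den-supported c ; den-supported = num-supported c
                         ; rows-shifted = ↭-sym (rows-shifted c) ; cols-balanced = ↭-sym (cols-balanced c) }

    connection-trans : ∀ {u v w} → Connection L u v → Connection L v w → Connection L u w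
    connection-trans c d = record
      { num = num c ++ num d ; den = den c ++ den d
      ; num-supported = ++⁺ (num-supported c) (num-supported d)
      ; den-supported = ++⁺ (den-supported c) (den-supported d)
      ; rows-shifted = ↭-trans (↭-reflexive (cong (_ ∷_) (map-++ proj₁ (num c) (num d))))
          (↭-trans (↭-∷-trans (rows-shifted c) (rows-shifted d))
                   (↭-reflexive (cong (_ ∷_) (sym (map-++ proj₁ (den c) (den d))))))
      ; cols-balanced = ↭-trans (↭-reflexive (map-++ proj₂ (num c) (num d)))
          (↭-trans (++⁺-↭ (cols-balanced c) (cols-balanced d))
                   (↭-reflexive (sym (map-++ proj₂ (den c) (den d)))))
      }

  OnDiagonalOrIn-∷ : ∀ {L e} → OnDiagonalOrIn L ⊆ OnDiagonalOrIn (e ∷ L)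
  OnDiagonalOrIn-∷ (inj₁ diag) = inj₁ diag
  OnDiagonalOrIn-∷ (inj₂ e∈L)  = inj₂ (there e∈L)

  connection-weaken : ∀ {L e v w} → Connection L v w → Connection (e ∷ L) v w
  connection-weaken c = record
    { num = num ; den = den
    ; num-supported = All.map OnDiagonalOrIn-∷ num-supported
    ; den-supported = All.map OnDiagonalOrIn-∷ den-supported
    ; rows-shifted = rows-shifted ; cols-balanced = cols-balanced }
    where open Connection c

  connection-edge : ∀ {L} i j → Connection ((i , j) ∷ L) i j
  connection-edge i j = record
    { num = (i , j) ∷ [] ; den = (j , j) ∷ []
    ; num-supported = inj₂ (here refl) ∷ [] ; den-supported = inj₁ refl ∷ []
    ; rows-shifted = swap j i refl ; cols-balanced = refl }

  record Cycle (L : List (Entry n)) : Set where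
    field
      num den       : List (Entry n)
      num-supported : All (OnDiagonalOrIn L) num
      den-supported : All (OnDiagonalOrIn L) den
      entry         : Entry n
      entry∈num     : entry ∈ num
      entry∉den     : entry ∉ den
      balanced      : Balanced num den

  cycle-weaken : ∀ {L e} → Cycle L → Cycle (e ∷ L)
  cycle-weaken c = record
    { num = num ; den = den
    ; num-supported = All.map OnDiagonalOrIn-∷ num-supported
    ; den-supported = All.map OnDiagonalOrIn-∷ den-supported
    ; entry = entry ; entry∈num = entry∈num ; entry∉den = entry∉den ; balanced = balanced }
    where open Cycle c

  cycle-close : ∀ {L i j} → i ≢ j → (i , j) ∉ L → Connection L i j → Cycle ((i , j) ∷ L)
  cycle-close {L} {i} {j} i≢j ij∉L c = record
    { num = (i , j) ∷ den ; den = (j , j) ∷ num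
    ; num-supported = inj₂ (here refl) ∷ All.map OnDiagonalOrIn-∷ den-supported
    ; den-supported = inj₁ refl ∷ All.map OnDiagonalOrIn-∷ num-supported
    ; entry = i , j ; entry∈num = here refl
    ; entry∉den = All¬⇒¬Any ((λ eq → i≢j (cong proj₁ eq)) ∷ All.map differs num-supported)
    ; balanced = ↭-sym rows-shifted , prep j (↭-sym cols-balanced) }
    where
    open Connection c
    differs : ∀ {e} → OnDiagonalOrIn L e → (i , j) ≢ e
    differs (inj₁ diag) refl = i≢j diag
    differs (inj₂ e∈L)  refl = ij∉L e∈L

  #roots : (Fin n → Fin n) → ℕ
  #roots root = length (filter (λ v → root v ≟ v) (allFin n))

  record Components (L : List (Entry n)) : Set where
    field
      root      : Fin n → Fin n
      root-idem : ∀ v → root (root v) ≡ root v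
      path      : ∀ v → Connection L v (root v)
      size      : length L + #roots root ≤ n

  discrete : Components []
  discrete = record
    { root = λ v → v ; root-idem = λ _ → refl ; path = connection-refl
    ; size = ≤-trans (length-filter (λ v → v ≟ v) (allFin n)) (≤-reflexive (length-tabulate (λ v → v))) }

  components-bound : ∀ {L} → Components L → length L ≤ n ∸ 1
  components-bound {L} cs = m+k≤o⇒m≤o∸1 (length L) n size (λ v → ∈⇒length≥1 (root-∈ v))
    where
    open Components cs
    root-∈ : ∀ v → root v ∈ filter (λ w → root w ≟ w) (allFin n)
    root-∈ v = ∈-filter⁺ (λ w → root w ≟ w) (∈-allFin (root v)) (root-idem v)

  module _ {L : List (Entry n)} (cs : Components L) {i j : Fin n}
           (i≁j : Components.root cs i ≢ Components.root cs j) where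
    open Components cs

    merged : Fin n → Fin n
    merged v with root v ≟ root j
    ... | yes _ = root i
    ... | no _  = root v

    merged-unmoved : ∀ {w} → root w ≢ root j → merged w ≡ root w
    merged-unmoved {w} w≁j with root w ≟ root j
    ... | yes w∼j = ⊥-elim (w≁j w∼j)
    ... | no _    = refl

    merged-moved : ∀ {w} → root w ≡ root j → merged w ≡ root i
    merged-moved {w} w∼j with root w ≟ root j
    ... | yes _   = refl
    ... | no w≁j  = ⊥-elim (w≁j w∼j)

    merged-idem : ∀ v → merged (merged v) ≡ merged v
    merged-idem v with root v ≟ root j
    ... | yes _   = trans (merged-unmoved (λ eq → i≁j (trans (sym (root-idem i)) eq))) (root-idem i)
    ... | no v≁j  = trans (merged-unmoved (λ eq → v≁j (trans (sym (root-idem v)) eq))) (root-idem v)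

    merged-path : ∀ v → Connection ((i , j) ∷ L) v (merged v)
    merged-path v with root v ≟ root j
    ... | yes v∼j = connection-trans (subst (Connection _ v) v∼j (connection-weaken (path v)))
                      (connection-trans (connection-sym (connection-weaken (path j)))
                        (connection-trans (connection-sym (connection-edge i j)) (connection-weaken (path i))))
    ... | no _    = connection-weaken (path v)

    merged-fixed : ∀ {v} → merged v ≡ v → root v ≡ v
    merged-fixed {v} with root v ≟ root j
    ... | yes _ = λ root-i≡v → subst (λ z → root z ≡ z) root-i≡v (root-idem i)
    ... | no _  = λ root-v≡v → root-v≡v

    merged-fewer-roots : #roots merged < #roots root
    merged-fewer-roots =
      length-filter-< (λ v → root v ≟ v) (λ v → merged v ≟ v) merged-fixed
        (allFin n) (∈-allFin (root j)) (root-idem j)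
        (λ eq → i≁j (trans (sym (merged-moved (root-idem j))) eq))

    union : Components ((i , j) ∷ L)
    union = record
      { root = merged ; root-idem = merged-idem ; path = merged-path
      ; size = ≤-trans (≤-reflexive (sym (+-suc (length L) (#roots merged))))
                 (≤-trans (+-monoʳ-≤ (length L) merged-fewer-roots) size) }

  forest-or-cycle : (L : List (Entry n)) → All (λ e → proj₁ e ≢ proj₂ e) L → Unique L →
                    Components L ⊎ Cycle L
  forest-or-cycle []            _                _           = inj₁ discrete
  forest-or-cycle ((i , j) ∷ L) (i≢j ∷ loopless) (fresh ∷ unique)
    with forest-or-cycle L loopless unique
  ... | inj₂ cycle = inj₂ (cycle-weaken cycle)
  ... | inj₁ cs with Components.root cs i ≟ Components.root cs j
  ...   | no i≁j = inj₁ (union cs i≁j)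
  ...   | yes i∼j = inj₂ (cycle-close i≢j (All¬⇒¬Any fresh)
                     (connection-trans (subst (Connection L i) i∼j (Components.path cs i))
                                       (connection-sym (Components.path cs j))))

module _ {n : ℕ} (P : FinPoset n) where
  open FinPoset P

  Related : Pred (Entry n) 0ℓ
  Related e = proj₁ e ≤P proj₂ e

  nontrivial? : Decidable (λ (e : Entry n) → ¬ proj₁ e ≡ proj₂ e × Related e)
  nontrivial? e = ¬? (proj₁ e ≟ proj₂ e) ×-dec (proj₁ e ≤P? proj₂ e)

  nontrivialPairs : List (Entry n)
  nontrivialPairs = filter nontrivial? (cartesianProduct (allFin n) (allFin n))

  nontrivialPairs-loopless : All (λ e → proj₁ e ≢ proj₂ e) nontrivialPairs
  nontrivialPairs-loopless = All.map proj₁ (all-filter nontrivial? (cartesianProduct (allFin n) (allFin n)))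

  nontrivialPairs-unique : Unique nontrivialPairs
  nontrivialPairs-unique =
    Unique.filter⁺ nontrivial? (Unique.cartesianProduct⁺ (Unique.allFin⁺ n) (Unique.allFin⁺ n))

  OnDiagonalOrIn-nontrivialPairs⇒Related : OnDiagonalOrIn nontrivialPairs ⊆ Related
  OnDiagonalOrIn-nontrivialPairs⇒Related (inj₁ refl) = IsPartialOrder.refl isPartialOrder
  OnDiagonalOrIn-nontrivialPairs⇒Related (inj₂ e∈pairs) =
    proj₂ (proj₂ (∈-filter⁻ nontrivial? {xs = cartesianProduct (allFin n) (allFin n)} e∈pairs))

module _ {c ℓ : Level} (K : CommutativeRing c ℓ) where
  open CommutativeRing K renaming (refl to ≈-refl; sym to ≈-sym; trans to ≈-trans)
  open import Relation.Binary.Reasoning.Setoid setoid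
  open import Algebra.Properties.CommutativeSemigroup *-commutativeSemigroup using (interchange; x∙yz≈y∙xz; xy∙z≈xz∙y)
  open import Algebra.Properties.Group +-group using (x∙y⁻¹≈ε⇒x≈y; x≈y⇒x∙y⁻¹≈ε)

  product-↭ : ∀ {xs ys} → xs ↭ ys → foldr _*_ 1# xs ≈ foldr _*_ 1# ys
  product-↭ p = PermutationProperties.foldr-commMonoid setoid *-isCommutativeMonoid (↭⇒↭ₛ′ isEquivalence p)

  module _ {n : ℕ} where

    monomial : Matrix K n → List (Entry n) → Carrier
    monomial f m = foldr _*_ 1# (map (uncurry f) m)

    monomial-cong : ∀ {f g : Matrix K n} → (∀ i j → f i j ≈ g i j) → ∀ m → monomial f m ≈ monomial g m
    monomial-cong f≈g []            = ≈-refl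
    monomial-cong f≈g ((i , j) ∷ m) = *-cong (f≈g i j) (monomial-cong f≈g m)

    monomial-* : ∀ (f g : Matrix K n) m → monomial (λ i j → f i j * g i j) m ≈ monomial f m * monomial g m
    monomial-* f g []            = ≈-sym (*-identityʳ 1#)
    monomial-* f g ((i , j) ∷ m) = ≈-trans (*-congˡ (monomial-* f g m)) (interchange _ _ _ _)

    monomial-resp-↭ : ∀ {A : Set} (π : Entry n → A) (a : A → Carrier) {m m′} → map π m ↭ map π m′ →
                      monomial (λ i j → a (π (i , j))) m ≈ monomial (λ i j → a (π (i , j))) m′
    monomial-resp-↭ π a {m} {m′} p = begin
      foldr _*_ 1# (map (a ∘ π) m)    ≡⟨ cong (foldr _*_ 1#) (map-∘ m) ⟩
      foldr _*_ 1# (map a (map π m))  ≈⟨ product-↭ (map⁺ a p) ⟩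
      foldr _*_ 1# (map a (map π m′)) ≡⟨ cong (foldr _*_ 1#) (map-∘ m′) ⟨
      foldr _*_ 1# (map (a ∘ π) m′)   ∎

    character : Torus K n → Torus K n → Matrix K n
    character s t i j = Unit.val (s i) * Unit.inv (t j)

    monomial-act : ∀ s t x m → monomial (act K s t x) m ≈ monomial (character s t) m * monomial x m
    monomial-act s t x m = ≈-trans (monomial-cong (λ i j → xy∙z≈xz∙y _ _ _) m) (monomial-* (character s t) x m)

    character-balanced : ∀ s t {num den} → Balanced num den →
                         monomial (character s t) num ≈ monomial (character s t) den
    character-balanced s t {num} {den} (rows↭ , cols↭) = begin
      monomial (character s t) num ≈⟨ monomial-* (λ i _ → Unit.val (s i)) (λ _ j → Unit.inv (t j)) num ⟩
      monomial (λ i _ → Unit.val (s i)) num * monomial (λ _ j → Unit.inv (t j)) num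
        ≈⟨ *-cong (monomial-resp-↭ proj₁ (Unit.val ∘ s) rows↭) (monomial-resp-↭ proj₂ (Unit.inv ∘ t) cols↭) ⟩
      monomial (λ i _ → Unit.val (s i)) den * monomial (λ _ j → Unit.inv (t j)) den
        ≈⟨ monomial-* (λ i _ → Unit.val (s i)) (λ _ j → Unit.inv (t j)) den ⟨
      monomial (character s t) den ∎

    orbit-relation : ∀ {x y num den} → Balanced num den → InOrbit K x y →
                     monomial y num * monomial x den ≈ monomial y den * monomial x num
    orbit-relation {x} {y} {num} {den} balanced (s , t , y≈sxt) = begin
      monomial y num * monomial x den
        ≈⟨ *-congʳ (≈-trans (monomial-cong y≈sxt num) (monomial-act s t x num)) ⟩
      (monomial (character s t) num * monomial x num) * monomial x den
        ≈⟨ *-congʳ (*-congʳ (character-balanced s t balanced)) ⟩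
      (monomial (character s t) den * monomial x num) * monomial x den
        ≈⟨ xy∙z≈xz∙y _ _ _ ⟩
      (monomial (character s t) den * monomial x den) * monomial x num
        ≈⟨ *-congʳ (≈-trans (monomial-cong y≈sxt den) (monomial-act s t x den)) ⟨
      monomial y den * monomial x num ∎

    indicator : {S : Pred (Entry n) 0ℓ} → Decidable S → Matrix K n
    indicator S? i j = if does (S? (i , j)) then 1# else 0#

    module _ {S : Pred (Entry n) 0ℓ} (S? : Decidable S) where

      indicator-∈ : ∀ {i j} → S (i , j) → indicator S? i j ≈ 1#
      indicator-∈ {i} {j} s with S? (i , j)
      ... | yes _  = ≈-refl
      ... | no ¬s  = ⊥-elim (¬s s)

      indicator-∉ : ∀ {i j} → ¬ S (i , j) → indicator S? i j ≈ 0#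
      indicator-∉ {i} {j} ¬s with S? (i , j)
      ... | yes s = ⊥-elim (¬s s)
      ... | no _  = ≈-refl

      monomial-indicator-∈ : ∀ {m} → All S m → monomial (indicator S?) m ≈ 1#
      monomial-indicator-∈ []       = ≈-refl
      monomial-indicator-∈ (s ∷ ss) = ≈-trans (*-cong (indicator-∈ s) (monomial-indicator-∈ ss)) (*-identityˡ 1#)

      monomial-indicator-∉ : ∀ {e m} → e ∈ m → ¬ S e → monomial (indicator S?) m ≈ 0#
      monomial-indicator-∉ (here refl) ¬s = ≈-trans (*-congʳ (indicator-∉ ¬s)) (zeroˡ _)
      monomial-indicator-∉ (there e∈m)   ¬s = ≈-trans (*-congˡ (monomial-indicator-∉ e∈m ¬s)) (zeroʳ _)

    monomialPoly : List (Entry n) → Poly K n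
    monomialPoly []            = con 1#
    monomialPoly ((i , j) ∷ m) = var i j ⊗ monomialPoly m

    eval-monomialPoly : ∀ m y → eval K (monomialPoly m) y ≈ monomial y m
    eval-monomialPoly []            y = ≈-refl
    eval-monomialPoly ((i , j) ∷ m) y = *-congˡ (eval-monomialPoly m y)

    relationPoly : Matrix K n → List (Entry n) → List (Entry n) → Poly K n
    relationPoly x num den = (monomialPoly num ⊗ con (monomial x den)) ⊕ neg (monomialPoly den ⊗ con (monomial x num))

    eval-relationPoly : ∀ x num den y →
      eval K (relationPoly x num den) y ≈ monomial y num * monomial x den - monomial y den * monomial x num
    eval-relationPoly x num den y =
      +-cong (*-congʳ (eval-monomialPoly num y)) (-‿cong (*-congʳ (eval-monomialPoly den y)))

  module _ (0≉1 : ¬ 0# ≈ 1#) (inverse : ∀ a → ¬ a ≈ 0# → ∃ λ b → a * b ≈ 1#) where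

    *-≉0 : ∀ {a b} → ¬ a ≈ 0# → ¬ b ≈ 0# → ¬ a * b ≈ 0#
    *-≉0 {a} {b} a≉0 b≉0 ab≈0 with inverse a a≉0
    ... | a⁻¹ , aa⁻¹≈1 = b≉0 (begin
      b              ≈⟨ *-identityˡ b ⟨
      1# * b         ≈⟨ *-congʳ aa⁻¹≈1 ⟨
      (a * a⁻¹) * b  ≈⟨ ≈-trans (*-assoc a a⁻¹ b) (x∙yz≈y∙xz a a⁻¹ b) ⟩
      a⁻¹ * (a * b)  ≈⟨ *-congˡ ab≈0 ⟩
      a⁻¹ * 0#       ≈⟨ zeroʳ a⁻¹ ⟩
      0#             ∎)

    monomial≉0 : ∀ {n} {f : Matrix K n} {m} → All (λ e → ¬ uncurry f e ≈ 0#) m → ¬ monomial f m ≈ 0#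
    monomial≉0 []           = 0≉1 ∘ ≈-sym
    monomial≉0 (fe≉0 ∷ fm≉0) = *-≉0 fe≉0 (monomial≉0 fm≉0)

    module _ {n : ℕ} (P : FinPoset n) (x : Matrix K n) (dense : IsDenseIn K P (InOrbit K x)) where
      open FinPoset P

      indicator-incidence : ∀ {S} (S? : Decidable S) → (S ⊆ Related P) → InIncidence K P (indicator S?)
      indicator-incidence S? S⊆Related i j i≰j = indicator-∉ S? (i≰j ∘ S⊆Related)

      vanishes-on-incidence : ∀ p → (∀ y → InOrbit K x y → eval K p y ≈ 0#) →
                              ∀ y → InIncidence K P y → eval K p y ≈ 0#
      vanishes-on-incidence p on-orbit y y∈I = All.head (dense (p ∷ []) (λ z z∈O → on-orbit z z∈O ∷ []) y y∈I)

      entry≉0 : ∀ {i j} → i ≤P j → ¬ x i j ≈ 0#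
      entry≉0 {i} {j} i≤j xij≈0 = 0≉1 (begin
        0#                   ≈⟨ vanishes-on-incidence (var i j) on-orbit (indicator at-ij?) (indicator-incidence at-ij? at-ij⇒Related) ⟨
        indicator at-ij? i j ≈⟨ indicator-∈ at-ij? refl ⟩
        1#                   ∎)
        where
        at-ij? : Decidable (_≡ (i , j))
        at-ij? e = ≡-dec _≟_ _≟_ e (i , j)
        at-ij⇒Related : ∀ {e} → e ≡ (i , j) → Related P e
        at-ij⇒Related refl = i≤j
        on-orbit : ∀ y → InOrbit K x y → y i j ≈ 0#
        on-orbit y (s , t , y≈sxt) = begin
          y i j                                    ≈⟨ y≈sxt i j ⟩
          Unit.val (s i) * x i j * Unit.inv (t j)  ≈⟨ *-congʳ (≈-trans (*-congˡ xij≈0) (zeroʳ _)) ⟩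
          0# * Unit.inv (t j)                      ≈⟨ zeroˡ _ ⟩
          0#                                       ∎

      balanced-relation-on-incidence : ∀ {num den} → Balanced num den → ∀ y → InIncidence K P y →
                                       monomial y num * monomial x den ≈ monomial y den * monomial x num
      balanced-relation-on-incidence {num} {den} balanced y y∈I = x∙y⁻¹≈ε⇒x≈y _ _ (begin
        monomial y num * monomial x den - monomial y den * monomial x num ≈⟨ eval-relationPoly x num den y ⟨
        eval K (relationPoly x num den) y                                ≈⟨ vanishes-on-incidence (relationPoly x num den) on-orbit y y∈I ⟩
        0#                                                               ∎)
        where
        on-orbit : ∀ z → InOrbit K x z → eval K (relationPoly x num den) z ≈ 0#
        on-orbit z z∈O = ≈-trans (eval-relationPoly x num den z) (x≈y⇒x∙y⁻¹≈ε (orbit-relation balanced z∈O))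

      no-balanced-relation : ∀ {num den e} → Balanced num den → All (Related P) num → All (Related P) den →
                             e ∈ num → e ∉ den → ⊥
      no-balanced-relation {num} {den} {e} balanced num-related den-related e∈num e∉den =
        monomial≉0 (All.map entry≉0 num-related) (begin
          monomial x num                   ≈⟨ *-identityˡ _ ⟨
          1# * monomial x num              ≈⟨ *-congʳ (monomial-indicator-∈ off-e? den-off-e) ⟨
          monomial y den * monomial x num  ≈⟨ balanced-relation-on-incidence balanced y y∈I ⟨
          monomial y num * monomial x den  ≈⟨ *-congʳ (monomial-indicator-∉ off-e? e∈num (λ s → proj₂ s refl)) ⟩
          0# * monomial x den              ≈⟨ zeroˡ _ ⟩
          0#                               ∎)
        where
        off-e? : Decidable (λ e′ → Related P e′ × e ≢ e′)
        off-e? (i , j) = (i ≤P? j) ×-dec ¬? (≡-dec _≟_ _≟_ e (i , j))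
        y : Matrix K n
        y = indicator off-e?
        y∈I : InIncidence K P y
        y∈I = indicator-incidence off-e? proj₁
        den-off-e : All (λ e′ → Related P e′ × e ≢ e′) den
        den-off-e = All.zip (den-related , ¬Any⇒All¬ den e∉den)

lemma4p2 : ∀ {c ℓ : Level} (K : CommutativeRing c ℓ) → IsAlgClosedField K →
    ∀ (n : ℕ) (P : FinPoset n) → HasOpenDenseOrbit K P →
    nontrivialRelations P ≤ n ∸ 1
lemma4p2 K F n P (x , _ , _ , dense) =
  [ components-bound , ⊥-elim ∘ cycle-impossible ]′
    (forest-or-cycle (nontrivialPairs P) (nontrivialPairs-loopless P) (nontrivialPairs-unique P))
  where
  open IsAlgClosedField F
  cycle-impossible : Cycle (nontrivialPairs P) → ⊥
  cycle-impossible cycle =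
    no-balanced-relation K 0≉1 inverse P x dense balanced
      (All.map (OnDiagonalOrIn-nontrivialPairs⇒Related P) num-supported)
      (All.map (OnDiagonalOrIn-nontrivialPairs⇒Related P) den-supported)
      entry∈num entry∉den
    where open Cycle cycle
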